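{- Let $\mathcal F$ be a class of Kripke frames over a finite alphabet $\mathrm{Al}$ and $L=\mathrm{Log}\,\mathcal F$ its logic. Then $\mathrm{md}(L)\le \mathrm{md}(\mathcal F)+\mathrm{tra}(\mathcal F)+1$ (with $\omega+n=n+\omega=\omega$).
   Context: Kripke frame $F=(X,(R_\Diamond)_{\Diamond\in\mathrm{Al}})$; $\mathrm{Log}\,\mathcal F$ is the set of formulas valid in all frames of $\mathcal F$. $R_F=\bigcup_\Diamond R_\Diamond$; $F$ is $m$-transitive if $R_F^{m+1}\subseteq\bigcup_{i\le m}R_F^i$; $\mathrm{tra}(\mathcal F)$ is the least $m$ with every frame of $\mathcal F$ $m$-transitive ($\omega$ if none). Modal depth of frames: for $\mathcal V\subseteq\mathcal P(X)$, $a\equiv_{\mathcal V}b$ iff $\forall V\in\mathcal V\,(a\in V\Leftrightarrow b\in V)$; $\sim_{\mathcal V,0}=\equiv_{\mathcal V}$, $\mathcal V_0=X/{\sim_{\mathcal V,0}}$; for $d\ge1$, $\sim_{\mathcal V,d}$ is induced by $\mathcal V_{d-1}\cup\{R_\Diamond^{ -1}[V]:\Diamond\in\mathrm{Al},V\in\mathcal V_{d-1}\}$, $\mathcal V_d=X/{\sim_{\mathcal V,d}}$, $\mathcal V_\omega=\bigcup_d\mathcal V_d$; $\mathrm{md}(V)=\min\{d:V\in\mathcal V_d\}$; $\mathrm{md}(\mathcal V)=\sup_{V\in\mathcal V_\omega}\mathrm{md}(V)$; $\mathrm{md}(F)=\sup\{\mathrm{md}(\mathcal V):\mathcal V\subseteq\mathcal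 P(X)$ finite$\}$; $\mathrm{md}(\mathcal F)=\sup_{F\in\mathcal F}\mathrm{md}(F)$. Modal depth of a logic: $\mathrm{md}(\varphi)$ is the maximal modal nesting; $\mathrm{md}_L(\varphi)=\min\{\mathrm{md}(\psi):\varphi\leftrightarrow\psi\in L\}$; $\mathrm{md}(L)=\sup_\varphi\mathrm{md}_L(\varphi)$. -}

module Defs where

open import Level using (Level; Lift; 0ℓ; Setω) renaming (suc to lsuc)
open import Data.Nat using (ℕ; zero; suc; _≤_; _⊔_)
open import Data.Fin using (Fin)
open import Data.Product using (Σ; _×_; _,_)
open import Data.Sum using (_⊎_)
open import Data.Empty using (⊥)
open import Relation.Nullary using (¬_)
open import Relation.Binary.PropositionalEquality using (_≡_)
open import Function.Bundles using (_⇔_)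

-- Kripke frames over the finite alphabet Al = Fin k

record Frame (k : ℕ) : Set₁ where
  field
    Carrier : Set
    R       : Fin k → Carrier → Carrier → Set

open Frame public

FrameClass : ℕ → Set₂
FrameClass k = Frame k → Set₁

infixr 5 _⇒_

data Fm (k : ℕ) : Set where
  var  : ℕ → Fm k
  ⊥'   : Fm k
  _⇒_  : Fm k → Fm k → Fm k
  ◇    : Fin k → Fm k → Fm k

mdF : ∀ {k} → Fm k → ℕ
mdF (var _) = 0
mdF ⊥'      = 0
mdF (φ ⇒ ψ) = mdF φ ⊔ mdF ψ
mdF (◇ i φ) = suc (mdF φ)

_↔'_ : ∀ {k} → Fm k → Fm k → Fm k
-- φ ↔ ψ := (φ → ψ) ∧ (ψ → φ), with A ∧ B := (A → (B → ⊥)) → ⊥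
φ ↔' ψ = ((φ ⇒ ψ) ⇒ ((ψ ⇒ φ) ⇒ ⊥')) ⇒ ⊥'

_,_⊨_ : ∀ {k} (F : Frame k) → (ℕ → Carrier F → Set) → Carrier F → Fm k → Set
(F , θ ⊨ x) (var p) = θ p x
(F , θ ⊨ x) ⊥'      = ⊥
(F , θ ⊨ x) (φ ⇒ ψ) = (F , θ ⊨ x) φ → (F , θ ⊨ x) ψ
(F , θ ⊨ x) (◇ i φ) = Σ (Carrier F) λ y → R F i x y × (F , θ ⊨ y) φ

ValidIn : ∀ {k} → Fm k → Frame k → Set₁
ValidIn φ F = ∀ (θ : ℕ → Carrier F → Set) (x : Carrier F) → (F , θ ⊨ x) φ

_∈Log_ : ∀ {k} → Fm k → FrameClass k → Set₁
φ ∈Log 𝓕 = ∀ F → 𝓕 F → ValidIn φ F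

-- md(L) ≤ n  (md(L) = sup_φ md_L(φ), md_L(φ) = min{ md ψ : φ ↔ ψ ∈ L })
MdLogicLe : ∀ {k} → FrameClass k → ℕ → Set₁
MdLogicLe 𝓕 n = ∀ φ → Σ (Fm _) λ ψ → mdF ψ ≤ n × ((φ ↔' ψ) ∈Log 𝓕)

module _ {k : ℕ} (F : Frame k) where
  private X = Carrier F

  RF : X → X → Set
  RF x y = Σ (Fin k) λ i → R F i x y

  RPow : ℕ → X → X → Set
  RPow zero    x y = x ≡ y
  RPow (suc i) x y = Σ X λ z → RF x z × RPow i z y

  Transitive : ℕ → Set
  Transitive m = ∀ x y → RPow (suc m) x y → Σ ℕ λ i → i ≤ m × RPow i x y

-- tra(𝓕) ≤ n  (tra(𝓕) = least m with every frame of 𝓕 m-transitive)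
TraLe : ∀ {k} → FrameClass k → ℕ → Set₁
TraLe 𝓕 n = Σ ℕ λ m → m ≤ n × (∀ F → 𝓕 F → Transitive F m)

module _ {k : ℕ} (F : Frame k) {n : ℕ} (𝓥 : Fin n → Carrier F → Set) where
  private X = Carrier F

  Pre : Fin k → (X → Set) → X → Set
  Pre i V x = Σ X λ y → R F i x y × V y

  Sim : ℕ → X → X → Set₁
  -- V is an equivalence class of ∼_{𝓥,d}, i.e. V ∈ 𝓥_d = X/∼_{𝓥,d}
  Cls : ℕ → (X → Set) → Set₁

  Sim zero    a b = Lift (lsuc 0ℓ) (∀ (j : Fin n) → 𝓥 j a ⇔ 𝓥 j b)
  Sim (suc d) a b = ∀ (V : X → Set) → Cls d V →
                      (V a ⇔ V b) × (∀ (i : Fin k) → Pre i V a ⇔ Pre i V b)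

  Cls d V = Σ X λ a → ∀ (b : X) → V b ⇔ Sim d a b

  ClsΩ : (X → Set) → Set₁
  ClsΩ V = Σ ℕ λ d → Cls d V

  -- md(𝓥) ≤ m : every V ∈ 𝓥_ω has md(V) = min{d : V ∈ 𝓥_d} ≤ m
  MdPartLe : ℕ → Set₁
  MdPartLe m = ∀ (V : X → Set) → ClsΩ V → Σ ℕ λ d → d ≤ m × Cls d V

MdFrameLe : ∀ {k} → Frame k → ℕ → Set₁
MdFrameLe F m = ∀ (n : ℕ) (𝓥 : Fin n → Carrier F → Set) → MdPartLe F 𝓥 m

MdClassLe : ∀ {k} → FrameClass k → ℕ → Set₁
MdClassLe 𝓕 m = ∀ F → 𝓕 F → MdFrameLe F m

LEM : Setω
LEM = ∀ {ℓ : Level} (P : Set ℓ) → P ⊎ ¬ P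

-- Fix the n variables of φ. The variables together with the formulas ◇ᵢ ⋀ c, where c ranges over the
-- complete choices of literals among the corresponding formulas of depth d - 1, are finitely many
-- formulas of depth d, and agreement on them is agreement on every n-variable formula of depth ≤ d;
-- inside one model it is exactly ∼_{𝓥,d} for 𝓥 the truth sets of the variables. So md(F) ≤ m makes
-- depth-m agreement imply depth-(m+1) agreement within any model on F.
-- With D = m + t + 1 let ψ be the disjunction of those complete depth-D conjunctions that hold together
-- with φ somewhere in 𝓕. Then φ → ψ is immediate, and ψ → φ holds once points agreeing to depth D
-- satisfy the same formulas. To see this, link y and y' when they lie within t steps of such roots x
-- and x' and agree to depth m+1; this is a bisimulation. Given a successor z of y, pick a successor z'
-- of y' agreeing with z to depth m. By t-transitivity z lies j ≤ t steps from x, so x satisfies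
-- ◆^ j (depth-(m+1) type of z), a formula of depth ≤ D; hence so does x', and some w' agrees with z to
-- depth m+1. Then z' and w' agree to depth m, hence by stability to depth m+1, and so do z and z'.

module Submission where

open import Defs
open import Level using (lift)
open import Data.Nat using (ℕ; zero; suc; _+_; _≤_; _<_; _⊔_; z≤n; s≤s; _≤′_; ≤′-refl; ≤′-step)
open import Data.Nat.Properties
  using (≤-refl; ≤-reflexive; ≤-trans; ≤⇒≤′; n≤1+n; m≤n+m; m≤n⇒m<n∨m≡n;
         ⊔-lub; m≤m⊔n; m≤n⊔m; +-comm; +-monoˡ-≤)
open import Data.Fin using (Fin; toℕ; fromℕ<)
open import Data.Fin.Properties using (toℕ<n; toℕ-fromℕ<)
open import Data.List using (List; []; _∷_; _++_; map; filter; allFin; applyUpTo; cartesianProductWith)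
open import Data.List.Membership.Propositional using (_∈_; lose; find)
open import Data.List.Membership.Propositional.Properties
  using (∈-++⁺ˡ; ∈-++⁺ʳ; ∈-++⁻; ∈-map⁺; ∈-map⁻; ∈-allFin; ∈-applyUpTo⁺; ∈-applyUpTo⁻;
         ∈-cartesianProductWith⁺; ∈-cartesianProductWith⁻; ∈-filter⁺; ∈-filter⁻)
open import Data.List.Relation.Unary.All as All using (All; []; _∷_)
import Data.List.Relation.Unary.All.Properties as Allₚ
open import Data.List.Relation.Unary.Any using (Any; here; there; satisfied)
import Data.List.Relation.Unary.Any.Properties as Anyₚ
open import Data.Product using (Σ; _×_; _,_; proj₁; proj₂)
open import Data.Sum using (_⊎_; inj₁; inj₂; [_,_]′)
open import Data.Empty using (⊥; ⊥-elim)
open import Data.Unit using (⊤; tt)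
open import Relation.Nullary using (¬_)
open import Relation.Nullary.Decidable using (fromSum)
open import Relation.Unary using (Decidable)
open import Function using (id; const; _∘_)
open import Relation.Binary.PropositionalEquality using (refl; trans; subst)
open import Function.Bundles using (_⇔_; mk⇔; module Equivalence)
open Equivalence using (to; from)
import Function.Properties.Equivalence as ⇔

private
  variable
    k n d e : ℕ

¬' : Fm k → Fm k
¬' a = a ⇒ ⊥'

_∧'_ : Fm k → Fm k → Fm k
a ∧' b = ¬' (a ⇒ ¬' b)

⋀ : List (Fm k) → Fm k
⋀ []      = ¬' ⊥'
⋀ (a ∷ c) = a ∧' ⋀ c

⋁ : List (Fm k) → Fm k
⋁ []      = ⊥'
⋁ (a ∷ l) = ¬' a ⇒ ⋁ l

◆ : Fm k → Fm k
◆ ψ = ⋁ (map (λ i → ◇ i ψ) (allFin _))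

◆^ : ℕ → Fm k → Fm k
◆^ zero    ψ = ψ
◆^ (suc j) ψ = ◆ (◆^ j ψ)

data Fragment {k : ℕ} (n : ℕ) : ℕ → Fm k → Set where
  var : ∀ {d p} → p < n → Fragment n d (var p)
  ⊥'  : ∀ {d} → Fragment n d ⊥'
  _⇒_ : ∀ {d a b} → Fragment n d a → Fragment n d b → Fragment n d (a ⇒ b)
  ◇   : ∀ {d i a} → Fragment n d a → Fragment n (suc d) (◇ i a)

fragment-mono : ∀ {χ : Fm k} → d ≤ e → Fragment n d χ → Fragment n e χ
fragment-mono d≤e       (var p<n) = var p<n
fragment-mono d≤e       ⊥'        = ⊥'
fragment-mono d≤e       (a ⇒ b)   = fragment-mono d≤e a ⇒ fragment-mono d≤e b
fragment-mono (s≤s d≤e) (◇ a)     = ◇ (fragment-mono d≤e a)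

fragment-md : ∀ {χ : Fm k} → Fragment n d χ → mdF χ ≤ d
fragment-md (var _) = z≤n
fragment-md ⊥'      = z≤n
fragment-md (a ⇒ b) = ⊔-lub (fragment-md a) (fragment-md b)
fragment-md (◇ a)   = s≤s (fragment-md a)

fragment-⋀ : ∀ {c : List (Fm k)} → All (Fragment n d) c → Fragment n d (⋀ c)
fragment-⋀ []      = ⊥' ⇒ ⊥'
fragment-⋀ (a ∷ c) = (a ⇒ (fragment-⋀ c ⇒ ⊥')) ⇒ ⊥'

fragment-⋁ : ∀ {l : List (Fm k)} → All (Fragment n d) l → Fragment n d (⋁ l)
fragment-⋁ []      = ⊥'
fragment-⋁ (a ∷ l) = (a ⇒ ⊥') ⇒ fragment-⋁ l

fragment-◆ : ∀ {ψ : Fm k} → Fragment n d ψ → Fragment n (suc d) (◆ ψ)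
fragment-◆ ψ = fragment-⋁ (Allₚ.map⁺ (All.universal (λ _ → ◇ ψ) _))

fragment-◆^ : ∀ j {ψ : Fm k} → Fragment n d ψ → Fragment n (j + d) (◆^ j ψ)
fragment-◆^ zero    ψ = ψ
fragment-◆^ (suc j) ψ = fragment-◆ (fragment-◆^ j ψ)

varBound : Fm k → ℕ
varBound (var p) = suc p
varBound ⊥'      = zero
varBound (a ⇒ b) = varBound a ⊔ varBound b
varBound (◇ _ a) = varBound a

fragment-varBound : ∀ (φ : Fm k) → varBound φ ≤ n → Fragment n (mdF φ) φ
fragment-varBound (var p) p<n = var p<n
fragment-varBound ⊥'      _   = ⊥'
fragment-varBound (a ⇒ b) ≤n  =
  fragment-mono (m≤m⊔n (mdF a) (mdF b)) (fragment-varBound a (≤-trans (m≤m⊔n _ _) ≤n))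
  ⇒ fragment-mono (m≤n⊔m (mdF a) (mdF b)) (fragment-varBound b (≤-trans (m≤n⊔m _ _) ≤n))
fragment-varBound (◇ _ a) ≤n  = ◇ (fragment-varBound a ≤n)

data Choice {k : ℕ} : List (Fm k) → List (Fm k) → Set where
  []  : Choice [] []
  pos : ∀ {a L c} → Choice L c → Choice (a ∷ L) (a ∷ c)
  neg : ∀ {a L c} → Choice L c → Choice (a ∷ L) (¬' a ∷ c)

choices : List (Fm k) → List (List (Fm k))
choices []      = [] ∷ []
choices (a ∷ L) = map (a ∷_) (choices L) ++ map (¬' a ∷_) (choices L)

∈-choices⁺ : ∀ {L c : List (Fm k)} → Choice L c → c ∈ choices L
∈-choices⁺ []                  = here refl
∈-choices⁺ {L = a ∷ L} (pos ch) = ∈-++⁺ˡ (∈-map⁺ (a ∷_) (∈-choices⁺ ch))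
∈-choices⁺ {L = a ∷ L} (neg ch) =
  ∈-++⁺ʳ (map (a ∷_) (choices L)) (∈-map⁺ (¬' a ∷_) (∈-choices⁺ ch))

∈-choices⁻ : ∀ {L c : List (Fm k)} → c ∈ choices L → Choice L c
∈-choices⁻ {L = []}    (here refl) = []
∈-choices⁻ {L = a ∷ L} c∈ with ∈-++⁻ (map (a ∷_) (choices L)) c∈
... | inj₁ c∈⁺ with _ , c′∈ , refl ← ∈-map⁻ (a ∷_) c∈⁺ = pos (∈-choices⁻ c′∈)
... | inj₂ c∈⁻ with _ , c′∈ , refl ← ∈-map⁻ (¬' a ∷_) c∈⁻ = neg (∈-choices⁻ c′∈)

choice-fragment : ∀ {L c : List (Fm k)} → Choice L c → All (Fragment n d) L → All (Fragment n d) c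
choice-fragment []       []      = []
choice-fragment (pos ch) (a ∷ L) = a ∷ choice-fragment ch L
choice-fragment (neg ch) (a ∷ L) = (a ⇒ ⊥') ∷ choice-fragment ch L

variables : ℕ → List (Fm k)
variables n = applyUpTo var n

Atoms : ℕ → ℕ → List (Fm k)
Atoms n zero    = variables n
Atoms n (suc d) =
  variables n ++ cartesianProductWith (λ i c → ◇ i (⋀ c)) (allFin _) (choices (Atoms n d))

data Atom {k : ℕ} (n : ℕ) : ℕ → Fm k → Set where
  var : ∀ {d p} → p < n → Atom n d (var p)
  ◇   : ∀ {d c} i → Choice (Atoms n d) c → Atom n (suc d) (◇ i (⋀ c))

∈-atoms⁺ : ∀ {χ : Fm k} → Atom n d χ → χ ∈ Atoms n d
∈-atoms⁺ {d = zero}  (var p<n) = ∈-applyUpTo⁺ var p<n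
∈-atoms⁺ {d = suc d} (var p<n) = ∈-++⁺ˡ (∈-applyUpTo⁺ var p<n)
∈-atoms⁺ {n = n}     (◇ i ch)  =
  ∈-++⁺ʳ (variables n)
         (∈-cartesianProductWith⁺ (λ i c → ◇ i (⋀ c)) (∈-allFin i) (∈-choices⁺ ch))

∈-variables⁻ : ∀ {χ : Fm k} → χ ∈ variables n → Atom n d χ
∈-variables⁻ χ∈ with _ , p<n , refl ← ∈-applyUpTo⁻ var χ∈ = var p<n

∈-atoms⁻ : ∀ {χ : Fm k} → χ ∈ Atoms n d → Atom n d χ
∈-atoms⁻ {d = zero}          χ∈ = ∈-variables⁻ χ∈
∈-atoms⁻ {n = n} {d = suc d} χ∈ with ∈-++⁻ (variables n) χ∈
... | inj₁ χ∈ᵛ = ∈-variables⁻ χ∈ᵛ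
... | inj₂ χ∈◇
  with i , _ , _ , c∈ , refl ← ∈-cartesianProductWith⁻ (λ i c → ◇ i (⋀ c)) (allFin _) _ χ∈◇
  = ◇ i (∈-choices⁻ c∈)

atoms-fragment : ∀ d → All (Fragment n d) (Atoms {k} n d)
atom-fragment : ∀ {χ : Fm k} → Atom n d χ → Fragment n d χ
choice-⋀-fragment : ∀ {c : List (Fm k)} → Choice (Atoms n d) c → Fragment n d (⋀ c)

atoms-fragment d = All.tabulate (atom-fragment ∘ ∈-atoms⁻)

atom-fragment (var p<n) = var p<n
atom-fragment (◇ _ ch)  = ◇ (choice-⋀-fragment ch)

choice-⋀-fragment ch = fragment-⋀ (choice-fragment ch (atoms-fragment _))

record Model (k : ℕ) : Set₁ where
  constructor ⟨_,_⟩
  field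
    frame : Frame k
    val   : ℕ → Carrier frame → Set

open Model

World : Model k → Set
World M = Carrier (frame M)

Pointed : ℕ → Set₁
Pointed k = Σ (Model k) World

_⊩_ : Pointed k → Fm k → Set
(M , x) ⊩ χ = (frame M , val M ⊨ x) χ

Agree : List (Fm k) → Pointed k → Pointed k → Set
Agree L p q = All (λ χ → p ⊩ χ ⇔ q ⊩ χ) L

agree-sym : ∀ {L} {p q : Pointed k} → Agree L p q → Agree L q p
agree-sym = All.map ⇔.sym

agree-trans : ∀ {L} {p q r : Pointed k} → Agree L p q → Agree L q r → Agree L p r
agree-trans p≈q q≈r = All.zipWith (λ (p⇔q , q⇔r) → ⇔.trans p⇔q q⇔r) (p≈q , q≈r)

Reach : (F : Frame k) → ℕ → Carrier F → Carrier F → Set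
Reach F t x y = Σ ℕ λ j → j ≤ t × RPow F j x y

rpow-snoc : ∀ {F : Frame k} {j x y z} → RPow F j x y → RF F y z → RPow F (suc j) x z
rpow-snoc {j = zero}  refl            r = _ , r , refl
rpow-snoc {j = suc j} (w , r₀ , path) r = w , r₀ , rpow-snoc path r

reach-step : ∀ {F : Frame k} {t x y z} → Transitive F t → Reach F t x y → RF F y z → Reach F t x z
reach-step tra (j , j≤t , path) r with m≤n⇒m<n∨m≡n j≤t
... | inj₁ j<t  = suc j , j<t , rpow-snoc path r
... | inj₂ refl = tra _ _ (rpow-snoc path r)

module Classical (lem : LEM) where

  dne : ∀ {ℓ} {P : Set ℓ} → ¬ ¬ P → P
  dne {P = P} ¬¬p = [ id , ⊥-elim ∘ ¬¬p ]′ (lem P)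

  Resize : ∀ {ℓ} → Set ℓ → Set
  Resize P = [ const ⊤ , const ⊥ ]′ (lem P)

  resize : ∀ {ℓ} (P : Set ℓ) → Resize P ⇔ P
  resize P = decided (lem P)
    where
      decided : (s : P ⊎ ¬ P) → [ const ⊤ , const ⊥ ]′ s ⇔ P
      decided (inj₁ p)  = mk⇔ (const p) (const tt)
      decided (inj₂ ¬p) = mk⇔ ⊥-elim (⊥-elim ∘ ¬p)

  ⊩-∧ : ∀ {p : Pointed k} {a b} → p ⊩ (a ∧' b) ⇔ (p ⊩ a × p ⊩ b)
  ⊩-∧ = mk⇔
    (λ h → dne (λ ¬ha → h (λ ha _ → ¬ha ha)) , dne (λ ¬hb → h (λ _ hb → ¬hb hb)))
    (λ (ha , hb) h → h ha hb)

  ⊩-⋀ : ∀ {p : Pointed k} {c} → p ⊩ ⋀ c ⇔ All (p ⊩_) c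
  ⊩-⋀ {c = []}            = mk⇔ (const []) (const id)
  ⊩-⋀ {p = p} {c = a ∷ c} = ⇔.trans (⊩-∧ {p = p} {a} {⋀ c}) (mk⇔
    (λ (ha , hc) → ha ∷ to ⊩-⋀ hc)
    (λ { (ha ∷ hc) → ha , from ⊩-⋀ hc }))

  ⊩-⋁ : ∀ {p : Pointed k} {l} → p ⊩ ⋁ l ⇔ Any (p ⊩_) l
  ⊩-⋁ {l = []}            = mk⇔ (λ ()) (λ ())
  ⊩-⋁ {p = p} {l = a ∷ l} = mk⇔ forth back
    where
      forth : p ⊩ ⋁ (a ∷ l) → Any (p ⊩_) (a ∷ l)
      forth h = [ here , there ∘ to ⊩-⋁ ∘ h ]′ (lem (p ⊩ a))
      back : Any (p ⊩_) (a ∷ l) → p ⊩ ⋁ (a ∷ l)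
      back (here ha) ¬a = ⊥-elim (¬a ha)
      back (there hl) _ = from ⊩-⋁ hl

  ⊩-◆ : ∀ {M : Model k} {x ψ} →
        (M , x) ⊩ ◆ ψ ⇔ Σ (World M) λ y → RF (frame M) x y × (M , y) ⊩ ψ
  ⊩-◆ {k} {M} {x} {ψ} = ⇔.trans (⊩-⋁ {l = map (λ i → ◇ i ψ) (allFin k)}) (mk⇔ forth back)
    where
      forth : Any ((M , x) ⊩_) (map (λ i → ◇ i ψ) (allFin k)) →
              Σ (World M) λ y → RF (frame M) x y × (M , y) ⊩ ψ
      forth h with i , y , r , s ← satisfied (Anyₚ.map⁻ h) = y , (i , r) , s
      back : (Σ (World M) λ y → RF (frame M) x y × (M , y) ⊩ ψ) →
             Any ((M , x) ⊩_) (map (λ i → ◇ i ψ) (allFin k))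
      back (y , (i , r) , s) = Anyₚ.map⁺ (lose (∈-allFin i) (y , r , s))

  ⊩-◆^ : ∀ {M : Model k} {x ψ} j →
         (M , x) ⊩ ◆^ j ψ ⇔ Σ (World M) λ y → RPow (frame M) j x y × (M , y) ⊩ ψ
  ⊩-◆^ zero    = mk⇔ (λ s → _ , refl , s) (λ { (_ , refl , s) → s })
  ⊩-◆^ (suc j) = mk⇔
    (λ h → let (z , r , hz) = to ⊩-◆ h; (y , path , s) = to (⊩-◆^ j) hz in y , (z , r , path) , s)
    (λ (y , (z , r , path) , s) → from ⊩-◆ (z , r , from (⊩-◆^ j) (y , path , s)))

  choice-exists : ∀ (L : List (Fm k)) p → Σ (List (Fm k)) λ c → Choice L c × p ⊩ ⋀ c
  choice-exists L p = let (c , ch , hc) = decide L in c , ch , from ⊩-⋀ hc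
    where
      decide : ∀ L → Σ (List (Fm _)) λ c → Choice L c × All (p ⊩_) c
      decide []      = [] , [] , []
      decide (a ∷ L) with c , ch , hc ← decide L | lem (p ⊩ a)
      ... | inj₁ ha  = a ∷ c , pos ch , ha ∷ hc
      ... | inj₂ ¬ha = ¬' a ∷ c , neg ch , ¬ha ∷ hc

  choice-agree : ∀ {L c : List (Fm k)} {p q} → Choice L c → p ⊩ ⋀ c → (q ⊩ ⋀ c ⇔ Agree L p q)
  choice-agree {p = p} {q} ch hc = ⇔.trans ⊩-⋀ (agree ch (to ⊩-⋀ hc))
    where
      agree : ∀ {L c} → Choice L c → All (p ⊩_) c → All (q ⊩_) c ⇔ Agree L p q
      agree []       []          = mk⇔ (const []) (const [])
      agree (pos ch) (pa ∷ pc)   = mk⇔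
        (λ { (qa ∷ qc) → mk⇔ (const qa) (const pa) ∷ to (agree ch pc) qc })
        (λ { (a⇔ ∷ ag) → to a⇔ pa ∷ from (agree ch pc) ag })
      agree (neg ch) (¬pa ∷ pc)  = mk⇔
        (λ { (¬qa ∷ qc) → mk⇔ (⊥-elim ∘ ¬pa) (⊥-elim ∘ ¬qa) ∷ to (agree ch pc) qc })
        (λ { (a⇔ ∷ ag) → ¬pa ∘ from a⇔ ∷ from (agree ch pc) ag })

  module SimProperties (F : Frame k) {n} (𝓥 : Fin n → Carrier F → Set) where

    sim-refl : ∀ d {a} → Sim F 𝓥 d a a
    sim-refl zero    = lift λ _ → ⇔.refl
    sim-refl (suc d) = λ _ _ → ⇔.refl , λ _ → ⇔.refl

    sim-sym : ∀ d {a b} → Sim F 𝓥 d a b → Sim F 𝓥 d b a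
    sim-sym zero    (lift a⇔b) = lift (⇔.sym ∘ a⇔b)
    sim-sym (suc d) a∼b        = λ V cls →
      let (V⇔ , Pre⇔) = a∼b V cls in ⇔.sym V⇔ , ⇔.sym ∘ Pre⇔

    sim-trans : ∀ d {a b c} → Sim F 𝓥 d a b → Sim F 𝓥 d b c → Sim F 𝓥 d a c
    sim-trans zero    (lift a⇔b) (lift b⇔c) = lift λ j → ⇔.trans (a⇔b j) (b⇔c j)
    sim-trans (suc d) a∼b        b∼c        = λ V cls →
      let (V⇔ , Pre⇔) = a∼b V cls; (V⇔′ , Pre⇔′) = b∼c V cls
      in ⇔.trans V⇔ V⇔′ , λ i → ⇔.trans (Pre⇔ i) (Pre⇔′ i)

    -- Sim is Set₁-valued while Cls asks for Set-valued classes; excluded middle resizes them.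
    class : ℕ → Carrier F → Carrier F → Set
    class d a b = Resize (Sim F 𝓥 d a b)

    class-cls : ∀ d a → Cls F 𝓥 d (class d a)
    class-cls d a = a , λ b → resize (Sim F 𝓥 d a b)

    ∈-class-refl : ∀ d a → class d a a
    ∈-class-refl d a = from (resize _) (sim-refl d)

    sim-suc⇒sim : ∀ d {a b} → Sim F 𝓥 (suc d) a b → Sim F 𝓥 d a b
    sim-suc⇒sim d {a} a∼b =
      to (resize _) (to (proj₁ (a∼b (class d a) (class-cls d a))) (∈-class-refl d a))

    sim-anti-mono : ∀ {d e a b} → d ≤′ e → Sim F 𝓥 e a b → Sim F 𝓥 d a b
    sim-anti-mono ≤′-refl        a∼b = a∼b
    sim-anti-mono (≤′-step d≤′e) a∼b = sim-anti-mono d≤′e (sim-suc⇒sim _ a∼b)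

    sim-stable : ∀ {d a b} → MdPartLe F 𝓥 d → Sim F 𝓥 d a b → Sim F 𝓥 (suc d) a b
    sim-stable {d} {a} {b} md a∼b
      with d′ , d′≤d , c , V⇔ ← md (class (suc d) a) (suc d , class-cls (suc d) a) =
      to (resize _) (from (V⇔ b) (sim-trans d′ c∼a (sim-anti-mono (≤⇒≤′ d′≤d) a∼b)))
      where
        c∼a : Sim F 𝓥 d′ c a
        c∼a = to (V⇔ a) (∈-class-refl (suc d) a)

  module _ {k : ℕ} (n : ℕ) where

    infix 4 _≈[_]_
    _≈[_]_ : Pointed k → ℕ → Pointed k → Set
    p ≈[ d ] q = Agree (Atoms n d) p q

    ≈-atom : ∀ {d p q} {χ : Fm k} → p ≈[ d ] q → Atom n d χ → p ⊩ χ ⇔ q ⊩ χ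
    ≈-atom p≈q χ = All.lookup p≈q (∈-atoms⁺ χ)

    ≈-forth : ∀ {d M M' x x' i z} → (M , x) ≈[ suc d ] (M' , x') → R (frame M) i x z →
              Σ (World M') λ z' → R (frame M') i x' z' × (M , z) ≈[ d ] (M' , z')
    ≈-forth {d} {M} {i = i} {z} x≈x' r
      with c , ch , hc ← choice-exists (Atoms n d) (M , z)
      with z' , r' , hc' ← to (≈-atom x≈x' (◇ {d = d} i ch)) (z , r , hc)
      = z' , r' , to (choice-agree ch hc) hc'

    ≈-transfer : ∀ {d p q} {χ : Fm k} → p ≈[ d ] q → Fragment n d χ → p ⊩ χ → q ⊩ χ
    ≈-transfer {d} p≈q (var p<n) = to (≈-atom {d} p≈q (var p<n))
    ≈-transfer p≈q ⊥'        = id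
    ≈-transfer p≈q (a ⇒ b)   = λ h ha → ≈-transfer p≈q b (h (≈-transfer (agree-sym p≈q) a ha))
    ≈-transfer {suc d} p≈q (◇ a) (z , r , hz) with z' , r' , z≈z' ← ≈-forth {d} p≈q r =
      z' , r' , ≈-transfer z≈z' a hz

    ≈-transfer⇔ : ∀ {d p q} {χ : Fm k} → p ≈[ d ] q → Fragment n d χ → p ⊩ χ ⇔ q ⊩ χ
    ≈-transfer⇔ p≈q χ = mk⇔ (≈-transfer p≈q χ) (≈-transfer (agree-sym p≈q) χ)

    ≈-mono : ∀ {d e p q} → d ≤ e → p ≈[ e ] q → p ≈[ d ] q
    ≈-mono d≤e p≈q = All.map (≈-transfer⇔ p≈q ∘ fragment-mono d≤e) (atoms-fragment _)

    module _ (M : Model k) where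

      truthSets : Fin n → World M → Set
      truthSets j = val M (toℕ j)

      open SimProperties (frame M) truthSets

      private
        _∼[_]_ : World M → ℕ → World M → Set₁
        a ∼[ d ] b = Sim (frame M) truthSets d a b

      pre-definable : ∀ κ {V i a} → (∀ w → V w ⇔ (M , w) ⊩ κ) →
                      Pre (frame M) truthSets i V a ⇔ (M , a) ⊩ ◇ i κ
      pre-definable κ V⇔ = mk⇔ (λ (y , r , v) → y , r , to (V⇔ y) v)
                               (λ (y , r , s) → y , r , from (V⇔ y) s)

      sim⇒⊩var : ∀ d {a b p} → a ∼[ d ] b → p < n → val M p a → val M p b
      sim⇒⊩var d a∼b p<n with lift a⇔b ← sim-anti-mono (≤⇒≤′ z≤n) a∼b =
        subst (λ p → val M p _ → val M p _) (toℕ-fromℕ< p<n) (to (a⇔b (fromℕ< p<n)))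

      sim⇒≈ : ∀ d {a b} → a ∼[ d ] b → (M , a) ≈[ d ] (M , b)
      sim⇒⊩atom : ∀ d {a b} {χ : Fm k} → a ∼[ d ] b → Atom n d χ → (M , a) ⊩ χ → (M , b) ⊩ χ

      sim⇒≈ d a∼b = All.tabulate λ χ∈ →
        mk⇔ (sim⇒⊩atom d a∼b (∈-atoms⁻ χ∈)) (sim⇒⊩atom d (sim-sym d a∼b) (∈-atoms⁻ χ∈))

      sim⇒⊩atom d       a∼b (var p<n) = sim⇒⊩var d a∼b p<n
      sim⇒⊩atom (suc d) a∼b (◇ i ch)  (z , r , hz)
        with z' , r' , z∈ ← to (proj₂ (a∼b (class d z) (class-cls d z)) i) (z , r , ∈-class-refl d z)
        = z' , r' , from (choice-agree ch hz) (sim⇒≈ d (to (resize _) z∈))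

      ≈⇒sim : ∀ d {a b} → (M , a) ≈[ d ] (M , b) → a ∼[ d ] b
      class-definable : ∀ d {V} → Cls (frame M) truthSets d V →
                        Σ (List (Fm k)) λ c → Choice (Atoms n d) c × (∀ w → V w ⇔ (M , w) ⊩ ⋀ c)

      ≈⇒sim zero    a≈b = lift λ j → ≈-atom {zero} a≈b (var (toℕ<n j))
      ≈⇒sim (suc d) {a} {b} a≈b V cls with c , ch , V⇔ ← class-definable d cls = V-agree , Pre-agree
        where
          V-agree : V a ⇔ V b
          V-agree = ⇔.trans (V⇔ a)
                    (⇔.trans (≈-transfer⇔ a≈b (fragment-mono (n≤1+n d) (choice-⋀-fragment ch)))
                             (⇔.sym (V⇔ b)))
          Pre-agree : ∀ i → Pre (frame M) truthSets i V a ⇔ Pre (frame M) truthSets i V b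
          Pre-agree i = ⇔.trans (pre-definable (⋀ c) V⇔) (⇔.trans (≈-atom a≈b (◇ {d = d} i ch))
                                                                   (⇔.sym (pre-definable (⋀ c) V⇔)))

      class-definable d (c₀ , V⇔) with c , ch , hc ← choice-exists (Atoms n d) (M , c₀) =
        c , ch , λ w →
          ⇔.trans (V⇔ w) (⇔.trans (mk⇔ (sim⇒≈ d) (≈⇒sim d)) (⇔.sym (choice-agree ch hc)))

      ≈-stable : ∀ {m a b} → MdFrameLe (frame M) m →
                 (M , a) ≈[ m ] (M , b) → (M , a) ≈[ suc m ] (M , b)
      ≈-stable {m} md a≈b = sim⇒≈ (suc m) (sim-stable (md n truthSets) (≈⇒sim m a≈b))

    ≈-reach-forth : ∀ {D d j M M' x x' z} → (M , x) ≈[ D ] (M' , x') → j + d ≤ D →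
                    RPow (frame M) j x z → Σ (World M') λ z' → (M , z) ≈[ d ] (M' , z')
    ≈-reach-forth {d = d} {j} {M} {z = z} x≈x' j+d≤D path
      with c , ch , hc ← choice-exists (Atoms n d) (M , z)
      with z' , _ , hc' ← to (⊩-◆^ j)
                             (≈-transfer x≈x' (fragment-mono j+d≤D (fragment-◆^ j (choice-⋀-fragment ch)))
                                              (from (⊩-◆^ j) (z , path , hc)))
      = z' , to (choice-agree ch hc) hc'

    record IsBisimulation (Z : Pointed k → Pointed k → Set₁) : Set₁ where
      field
        sym   : ∀ {p q} → Z p q → Z q p
        atoms : ∀ {p q} → Z p q → p ≈[ 0 ] q
        forth : ∀ {M M' x x' i y} → Z (M , x) (M' , x') → R (frame M) i x y →
                Σ (World M') λ y' → R (frame M') i x' y' × Z (M , y) (M' , y')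

    bisimulation-transfer : ∀ {Z d p q} {χ : Fm k} →
                            IsBisimulation Z → Z p q → Fragment n d χ → p ⊩ χ → q ⊩ χ
    bisimulation-transfer bisim pZq (var p<n) = to (≈-atom {0} (IsBisimulation.atoms bisim pZq) (var p<n))
    bisimulation-transfer bisim pZq ⊥'        = id
    bisimulation-transfer bisim pZq (a ⇒ b)   = λ h ha →
      bisimulation-transfer bisim pZq b (h (bisimulation-transfer bisim (IsBisimulation.sym bisim pZq) a ha))
    bisimulation-transfer bisim pZq (◇ a) (y , r , hy)
      with y' , r' , yZy' ← IsBisimulation.forth bisim pZq r
      = y' , r' , bisimulation-transfer bisim yZy' a hy

    module _ (𝓕 : FrameClass k) {m t D : ℕ}
             (md : MdClassLe 𝓕 m) (tra : ∀ F → 𝓕 F → Transitive F t) (t+m<D : t + suc m ≤ D) where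

      record Linked (M : Model k) (y : World M) (M' : Model k) (y' : World M') : Set₁ where
        constructor linked
        field
          inClass  : 𝓕 (frame M)
          inClass' : 𝓕 (frame M')
          root     : World M
          root'    : World M'
          roots≈   : (M , root) ≈[ D ] (M' , root')
          reach    : Reach (frame M) t root y
          reach'   : Reach (frame M') t root' y'
          here≈    : (M , y) ≈[ suc m ] (M' , y')

      linked-sym : ∀ {M y M' y'} → Linked M y M' y' → Linked M' y' M y
      linked-sym (linked C C' x x' x≈x' rx rx' y≈y') =
        linked C' C x' x (agree-sym x≈x') rx' rx (agree-sym y≈y')

      linked-forth : ∀ {M M' y y' i z} → Linked M y M' y' → R (frame M) i y z →
                     Σ (World M') λ z' → R (frame M') i y' z' × Linked M z M' z'
      linked-forth {M} {M'} {i = i} (linked C C' x x' x≈x' rx ry' y≈y') r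
        with z' , r' , z≈z' ← ≈-forth {m} y≈y' r
           | j , j≤t , path ← reach-step (tra _ C) rx (i , r)
        with w' , z≈w' ← ≈-reach-forth x≈x' (≤-trans (+-monoˡ-≤ (suc m) j≤t) t+m<D) path
        = z' , r' , linked C C' x x' x≈x' (j , j≤t , path) (reach-step (tra _ C') ry' (i , r'))
                              (agree-trans z≈w' (agree-sym z'≈w'))
        where
          z'≈w' : (M' , z') ≈[ suc m ] (M' , w')
          z'≈w' = ≈-stable M' (md _ C') (agree-trans (agree-sym z≈z') (≈-mono (n≤1+n m) z≈w'))

      linked-isBisimulation : IsBisimulation λ (M , y) (M' , y') → Linked M y M' y'
      linked-isBisimulation = record
        { sym   = linked-sym
        ; atoms = ≈-mono {e = suc m} z≤n ∘ Linked.here≈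
        ; forth = linked-forth
        }

      Realizable : Fm k → List (Fm k) → Set₁
      Realizable φ c = Σ (Model k) λ M → 𝓕 (frame M) ×
                         Σ (World M) λ x → (M , x) ⊩ ⋀ c × (M , x) ⊩ φ

      realizable? : ∀ φ → Decidable (Realizable φ)
      realizable? φ c = fromSum (lem (Realizable φ c))

      normalForm : Fm k → Fm k
      normalForm φ = ⋁ (map ⋀ (filter (realizable? φ) (choices (Atoms n D))))

      normalForm-fragment : ∀ φ → Fragment n D (normalForm φ)
      normalForm-fragment φ = fragment-⋁ (Allₚ.map⁺ (All.tabulate λ c∈ →
        choice-⋀-fragment (∈-choices⁻ (proj₁ (∈-filter⁻ (realizable? φ) c∈)))))

      normalForm-equivalent : ∀ {e φ} → Fragment n e φ → (φ ↔' normalForm φ) ∈Log 𝓕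
      normalForm-equivalent {φ = φ} φ∈ F inF θ x h = h forth back
        where
          M = ⟨ F , θ ⟩
          forth : (M , x) ⊩ φ → (M , x) ⊩ normalForm φ
          forth hφ with c , ch , hc ← choice-exists (Atoms n D) (M , x) =
            from ⊩-⋁ (lose (∈-map⁺ ⋀ (∈-filter⁺ (realizable? φ) (∈-choices⁺ ch) realized)) hc)
            where
              realized : Realizable φ c
              realized = M , inF , x , hc , hφ
          back : (M , x) ⊩ normalForm φ → (M , x) ⊩ φ
          back h
            with _ , χ∈ , hχ ← find (to ⊩-⋁ h)
            with c , c∈ , refl ← ∈-map⁻ ⋀ χ∈
            with c∈ , (G , inG , y , hc , hφ) ← ∈-filter⁻ (realizable? φ) c∈ =
            bisimulation-transfer linked-isBisimulation
              (linked inG inF y x y≈x (0 , z≤n , refl) (0 , z≤n , refl)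
                      (≈-mono (≤-trans (m≤n+m (suc m) t) t+m<D) y≈x))
              φ∈ hφ
            where
              y≈x : (G , y) ≈[ D ] (M , x)
              y≈x = to (choice-agree (∈-choices⁻ c∈) hc) hχ

  md-logic-bound : ∀ {k} (𝓕 : FrameClass k) {m t D} →
                   MdClassLe 𝓕 m → (∀ F → 𝓕 F → Transitive F t) → t + suc m ≤ D → MdLogicLe 𝓕 D
  md-logic-bound 𝓕 md tra t+m<D φ =
    normalForm (varBound φ) 𝓕 md tra t+m<D φ ,
    fragment-md (normalForm-fragment (varBound φ) 𝓕 md tra t+m<D φ) ,
    normalForm-equivalent (varBound φ) 𝓕 md tra t+m<D (fragment-varBound φ ≤-refl)

theorem6p18 : LEM → ∀ (k : ℕ) (𝓕 : FrameClass k) (m t : ℕ) →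
    MdClassLe 𝓕 m → TraLe 𝓕 t → MdLogicLe 𝓕 (m + t + 1)
theorem6p18 lem k 𝓕 m t md (t′ , t′≤t , tra) = md-logic-bound 𝓕 md tra depth
  where
    open Classical lem
    depth : t′ + suc m ≤ m + t + 1
    depth = ≤-trans (+-monoˡ-≤ (suc m) t′≤t)
                    (≤-reflexive (trans (+-comm t (suc m)) (+-comm 1 (m + t))))
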